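{- Let $(S,\leq)$ be an ordered set admitting a partition $S=S_1\,\dot\cup\,S_2$ into disjoint nonempty finite subsets such that every $s_1\in S_1$ and every $s_2\in S_2$ are incomparable. Then the number of closure systems of $(S,\leq)$ equals the product of the number of closure systems of $(S_1,\leq|_{S_1})$ and the number of closure systems of $(S_2,\leq|_{S_2})$.
   Context: A subset $C$ of an ordered set $(P,\preceq)$ is a closure system if for every $p\in P$ the set $\{y\in C\mid p\preceq y\}$ has a least element. $\leq|_{S_i}$ denotes the restriction of $\leq$ to $S_i\times S_i$. -}

module Defs where

open import Level using (0ℓ)
open import Data.Nat using (ℕ; zero; suc)
open import Data.Fin using (Fin)
open import Data.Fin.Subset using (Subset; _∈_; _⊆_; inside; outside)
open import Data.Fin.Subset.Properties using (_∈?_; _⊆?_)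
open import Data.Fin.Properties using (any?; all?)
open import Data.Vec using ([]; _∷_)
open import Data.List using (List; []; _∷_; map; _++_; filter; length)
open import Data.Product using (∃; _×_)
open import Relation.Binary using (Rel; Decidable)
open import Relation.Nullary using (Dec)
open import Relation.Nullary.Decidable using (_×-dec_; _→-dec_)

allSubsets : (n : ℕ) → List (Subset n)
allSubsets zero    = [] ∷ []
allSubsets (suc n) = map (inside ∷_) (allSubsets n) ++ map (outside ∷_) (allSubsets n)

module _ {n : ℕ} (_≤_ : Rel (Fin n) 0ℓ) where

  -- C is a closure system of the ordered set (A, ≤|_A), where A ⊆ Fin n:
  -- C ⊆ A and for every p ∈ A the set {y ∈ C | p ≤ y} has a least element.
  IsClosureSystemIn : Subset n → Subset n → Set
  IsClosureSystemIn A C =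
    C ⊆ A ×
    (∀ p → p ∈ A →
      ∃ λ y → y ∈ C × p ≤ y × (∀ z → z ∈ C → p ≤ z → y ≤ z))

module _ {n : ℕ} {_≤_ : Rel (Fin n) 0ℓ} (_≤?_ : Decidable _≤_) where

  isClosureSystemIn? : (A C : Subset n) → Dec (IsClosureSystemIn _≤_ A C)
  isClosureSystemIn? A C =
    (C ⊆? A) ×-dec
    all? (λ p → (p ∈? A) →-dec
      any? (λ y → (y ∈? C) ×-dec ((p ≤? y) ×-dec
        all? (λ z → (z ∈? C) →-dec ((p ≤? z) →-dec (y ≤? z))))))

  numClosureSystems : Subset n → ℕ
  numClosureSystems A = length (filter (isClosureSystemIn? A) (allSubsets n))

-- Since no element of S₁ is comparable with one of S₂, both blocks are up-sets,
-- so for p ∈ Sᵢ the least element of C above p lies in Sᵢ ∩ C.  Hence C is a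
-- closure system of S exactly when S₁ ∩ C and S₂ ∩ C are closure systems of S₁
-- and S₂, and C ↦ (S₁ ∩ C , S₂ ∩ C) is a bijection onto such pairs.
module Submission where

open import Defs
open import Level using (0ℓ)
open import Data.Nat using (ℕ; _*_; _+_; suc)
open import Data.Nat.Properties using (*-distribʳ-+; *-distribˡ-+)
open import Data.Fin using (Fin)
open import Data.Fin.Subset
  using (Subset; _∈_; _⊆_; ⊤; ∁; _∩_; Nonempty; inside; outside)
open import Data.Fin.Subset.Properties
  using (drop-∷-⊆; x∈p∩q⁺; x∈p∩q⁻; ∈⊤; ⊆-antisym; x∈∁p⇒x∉p; x∉p⇒x∈∁p)
open import Data.List using (List; []; _∷_; map; _++_; filter; length)
open import Data.List.Properties using (filter-++; length-++; filter-none)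
open import Data.List.Relation.Unary.All using (universal)
open import Data.Product using (∃; _×_; _,_; proj₁; proj₂)
open import Data.Sum using (_⊎_; inj₁; inj₂; [_,_]′; swap)
open import Data.Bool using (true; false)
open import Data.Vec using ([]; _∷_; here)
open import Data.Empty using (⊥-elim)
open import Function using (_∘_)
open import Relation.Nullary using (¬_; Dec; yes; no; does)
open import Relation.Binary using (Rel; Decidable; IsPartialOrder)
open import Relation.Binary.PropositionalEquality
  using (_≡_; refl; cong; cong₂)
open Relation.Binary.PropositionalEquality.≡-Reasoning

length-filter-map : {A B : Set} {P : B → Set} (P? : ∀ x → Dec (P x)) (f : A → B)
  (xs : List A) →
  length (filter P? (map f xs)) ≡ length (filter (P? ∘ f) xs)
length-filter-map P? f [] = refl
length-filter-map P? f (x ∷ xs) with does (P? (f x))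
... | true  = cong suc (length-filter-map P? f xs)
... | false = length-filter-map P? f xs

count : ∀ {n} {P : Subset n → Set} → (∀ C → Dec (P C)) → ℕ
count {n} P? = length (filter P? (allSubsets n))

count-∷ : ∀ {n} {P : Subset (suc n) → Set} (P? : ∀ C → Dec (P C)) →
  count P? ≡ count (P? ∘ (inside ∷_)) + count (P? ∘ (outside ∷_))
count-∷ {n} P? = begin
  length (filter P? (insides ++ outsides))
    ≡⟨ cong length (filter-++ P? insides outsides) ⟩
  length (filter P? insides ++ filter P? outsides)
    ≡⟨ length-++ (filter P? insides) ⟩
  length (filter P? insides) + length (filter P? outsides)
    ≡⟨ cong₂ _+_ (length-filter-map P? (inside ∷_) (allSubsets n))
                 (length-filter-map P? (outside ∷_) (allSubsets n)) ⟩
  count (P? ∘ (inside ∷_)) + count (P? ∘ (outside ∷_)) ∎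
  where
  insides outsides : List (Subset (suc n))
  insides  = map (inside ∷_) (allSubsets n)
  outsides = map (outside ∷_) (allSubsets n)

count-∷-outside : ∀ {n} {S : Subset n} {P : Subset (suc n) → Set}
  (P? : ∀ C → Dec (P C)) → (∀ C → P C → C ⊆ outside ∷ S) →
  count P? ≡ count (P? ∘ (outside ∷_))
count-∷-outside {n} {P = P} P? P⊆S = begin
  count P?
    ≡⟨ count-∷ P? ⟩
  count (P? ∘ (inside ∷_)) + count (P? ∘ (outside ∷_))
    ≡⟨ cong (λ k → length k + count (P? ∘ (outside ∷_)))
            (filter-none (P? ∘ (inside ∷_)) (universal noInside (allSubsets n))) ⟩
  count (P? ∘ (outside ∷_)) ∎
  where
  noInside : ∀ C → ¬ P (inside ∷ C)
  noInside C p with P⊆S _ p here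
  ... | ()

count-∩-∁ : ∀ {n} (S : Subset n) {P Q R : Subset n → Set}
  (P? : ∀ C → Dec (P C)) (Q? : ∀ C → Dec (Q C)) (R? : ∀ C → Dec (R C)) →
  (∀ C → P C → C ⊆ S) → (∀ C → Q C → C ⊆ ∁ S) →
  (∀ C → R C → P (S ∩ C) × Q (∁ S ∩ C)) →
  (∀ C → P (S ∩ C) × Q (∁ S ∩ C) → R C) →
  count R? ≡ count P? * count Q?
count-∩-∁ [] P? Q? R? _ _ split join with R? [] | P? [] | Q? []
... | yes _ | yes _ | yes _ = refl
... | yes r | no ¬p | _     = ⊥-elim (¬p (proj₁ (split [] r)))
... | yes r | yes _ | no ¬q = ⊥-elim (¬q (proj₂ (split [] r)))
... | no ¬r | yes p | yes q = ⊥-elim (¬r (join [] (p , q)))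
... | no _  | no _  | _     = refl
... | no _  | yes _ | no _  = refl
count-∩-∁ (inside ∷ S) P? Q? R? P⊆S Q⊆∁S split join = begin
  count R?
    ≡⟨ count-∷ R? ⟩
  count (R? ∘ (inside ∷_)) + count (R? ∘ (outside ∷_))
    ≡⟨ cong₂ _+_ (restrictTo inside) (restrictTo outside) ⟩
  count (P? ∘ (inside ∷_)) * q + count (P? ∘ (outside ∷_)) * q
    ≡⟨ *-distribʳ-+ q (count (P? ∘ (inside ∷_))) (count (P? ∘ (outside ∷_))) ⟨
  (count (P? ∘ (inside ∷_)) + count (P? ∘ (outside ∷_))) * q
    ≡⟨ cong₂ _*_ (count-∷ P?) (count-∷-outside Q? Q⊆∁S) ⟨
  count P? * count Q? ∎
  where
  q : ℕ
  q = count (Q? ∘ (outside ∷_))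
  restrictTo : ∀ b → count (R? ∘ (b ∷_)) ≡ count (P? ∘ (b ∷_)) * q
  restrictTo b = count-∩-∁ S (P? ∘ (b ∷_)) (Q? ∘ (outside ∷_)) (R? ∘ (b ∷_))
    (λ C → drop-∷-⊆ ∘ P⊆S _) (λ C → drop-∷-⊆ ∘ Q⊆∁S _)
    (λ C → split (b ∷ C)) (λ C → join (b ∷ C))
count-∩-∁ (outside ∷ S) P? Q? R? P⊆S Q⊆∁S split join = begin
  count R?
    ≡⟨ count-∷ R? ⟩
  count (R? ∘ (inside ∷_)) + count (R? ∘ (outside ∷_))
    ≡⟨ cong₂ _+_ (restrictTo inside) (restrictTo outside) ⟩
  p * count (Q? ∘ (inside ∷_)) + p * count (Q? ∘ (outside ∷_))
    ≡⟨ *-distribˡ-+ p (count (Q? ∘ (inside ∷_))) (count (Q? ∘ (outside ∷_))) ⟨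
  p * (count (Q? ∘ (inside ∷_)) + count (Q? ∘ (outside ∷_)))
    ≡⟨ cong₂ _*_ (count-∷-outside P? P⊆S) (count-∷ Q?) ⟨
  count P? * count Q? ∎
  where
  p : ℕ
  p = count (P? ∘ (outside ∷_))
  restrictTo : ∀ b → count (R? ∘ (b ∷_)) ≡ p * count (Q? ∘ (b ∷_))
  restrictTo b = count-∩-∁ S (P? ∘ (outside ∷_)) (Q? ∘ (b ∷_)) (R? ∘ (b ∷_))
    (λ C → drop-∷-⊆ ∘ P⊆S _) (λ C → drop-∷-⊆ ∘ Q⊆∁S _)
    (λ C → split (b ∷ C)) (λ C → join (b ∷ C))

complement-unique : ∀ {n} {S T : Subset n} →
  (∀ x → x ∈ S ⊎ x ∈ T) → (∀ x → ¬ (x ∈ S × x ∈ T)) → T ≡ ∁ S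
complement-unique {S = S} cover disjoint = ⊆-antisym T⊆∁S ∁S⊆T
  where
  T⊆∁S : _ ⊆ ∁ S
  T⊆∁S {x} x∈T = x∉p⇒x∈∁p (λ x∈S → disjoint x (x∈S , x∈T))
  ∁S⊆T : ∁ S ⊆ _
  ∁S⊆T {x} x∈∁S with cover x
  ... | inj₁ x∈S = ⊥-elim (x∈∁p⇒x∉p x∈∁S x∈S)
  ... | inj₂ x∈T = x∈T

module _ {n : ℕ} (_≤_ : Rel (Fin n) 0ℓ) where

  UpClosed : Subset n → Set
  UpClosed S = ∀ {p y} → p ∈ S → p ≤ y → y ∈ S

  LeastAbove : Subset n → Fin n → Set
  LeastAbove C p = ∃ λ y → y ∈ C × p ≤ y × (∀ z → z ∈ C → p ≤ z → y ≤ z)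

  upClosed : ∀ {S T} → (∀ x → x ∈ S ⊎ x ∈ T) →
    (∀ {s t} → s ∈ S → t ∈ T → ¬ s ≤ t) → UpClosed S
  upClosed cover unrelated {p} {y} p∈S p≤y with cover y
  ... | inj₁ y∈S = y∈S
  ... | inj₂ y∈T = ⊥-elim (unrelated p∈S y∈T p≤y)

  leastAbove-∩⁺ : ∀ {S C p} → UpClosed S → p ∈ S →
    LeastAbove C p → LeastAbove (S ∩ C) p
  leastAbove-∩⁺ {S} {C} up p∈S (y , y∈C , p≤y , least) =
    y , x∈p∩q⁺ (up p∈S p≤y , y∈C) , p≤y ,
    λ z z∈S∩C → least z (proj₂ (x∈p∩q⁻ S C z∈S∩C))

  leastAbove-∩⁻ : ∀ {S C p} → UpClosed S → p ∈ S →
    LeastAbove (S ∩ C) p → LeastAbove C p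
  leastAbove-∩⁻ {S} {C} up p∈S (y , y∈S∩C , p≤y , least) =
    y , proj₂ (x∈p∩q⁻ S C y∈S∩C) , p≤y ,
    λ z z∈C p≤z → least z (x∈p∩q⁺ (up p∈S p≤z , z∈C)) p≤z

  isClosureSystem-∩ : ∀ {S C} → UpClosed S →
    IsClosureSystemIn _≤_ ⊤ C → IsClosureSystemIn _≤_ S (S ∩ C)
  isClosureSystem-∩ {S} {C} up (_ , least) =
    (λ x∈S∩C → proj₁ (x∈p∩q⁻ S C x∈S∩C)) ,
    λ p p∈S → leastAbove-∩⁺ up p∈S (least p ∈⊤)

  isClosureSystem-⊤ : ∀ {S T C} → (∀ x → x ∈ S ⊎ x ∈ T) →
    UpClosed S → UpClosed T →
    IsClosureSystemIn _≤_ S (S ∩ C) → IsClosureSystemIn _≤_ T (T ∩ C) →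
    IsClosureSystemIn _≤_ ⊤ C
  isClosureSystem-⊤ cover upS upT (_ , leastS) (_ , leastT) =
    (λ _ → ∈⊤) ,
    λ p _ → [ (λ p∈S → leastAbove-∩⁻ upS p∈S (leastS p p∈S))
            , (λ p∈T → leastAbove-∩⁻ upT p∈T (leastT p p∈T)) ]′ (cover p)

corollary7p2 : (n : ℕ) (_≤_ : Rel (Fin n) 0ℓ) →
    IsPartialOrder _≡_ _≤_ → (_≤?_ : Decidable _≤_) →
    (S₁ S₂ : Subset n) →
    (∀ x → x ∈ S₁ ⊎ x ∈ S₂) →
    (∀ x → ¬ (x ∈ S₁ × x ∈ S₂)) →
    Nonempty S₁ → Nonempty S₂ →
    (∀ s₁ s₂ → s₁ ∈ S₁ → s₂ ∈ S₂ → ¬ (s₁ ≤ s₂) × ¬ (s₂ ≤ s₁)) →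
    numClosureSystems _≤?_ ⊤ ≡ numClosureSystems _≤?_ S₁ * numClosureSystems _≤?_ S₂
corollary7p2 n _≤_ _ _≤?_ S₁ S₂ cover disjoint _ _ incomparable
  with refl ← complement-unique cover disjoint =
  count-∩-∁ S₁ (isClosureSystemIn? _≤?_ S₁) (isClosureSystemIn? _≤?_ S₂)
    (isClosureSystemIn? _≤?_ ⊤) (λ _ → proj₁) (λ _ → proj₁)
    (λ _ cs → isClosureSystem-∩ _≤_ up₁ cs , isClosureSystem-∩ _≤_ up₂ cs)
    (λ _ (cs₁ , cs₂) → isClosureSystem-⊤ _≤_ cover up₁ up₂ cs₁ cs₂)
  where
  up₁ : UpClosed _≤_ S₁
  up₁ = upClosed _≤_ cover (λ s₁ s₂ → proj₁ (incomparable _ _ s₁ s₂))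
  up₂ : UpClosed _≤_ S₂
  up₂ = upClosed _≤_ (swap ∘ cover) (λ s₂ s₁ → proj₂ (incomparable _ _ s₁ s₂))
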